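{- Let $G=(V,E)$ be a strongly biconnected directed graph and let $U_1,U_2$ be two distinct $2$-edge-biconnected blocks of $G$. Then $|U_1\cap U_2|\leq 1$.
   Context: A directed graph is strongly biconnected if it is strongly connected and its underlying undirected graph is biconnected. For a directed graph $H$, a strongly biconnected component of $H$ is a maximal vertex subset $C$ such that the subgraph induced by $C$ is strongly biconnected. For an edge $b$, $G\setminus\{b\}=(V,E\setminus\{b\})$. For distinct $x,y\in V$, write $x \overset{e}{\leftrightsquigarrow} y$ if for every edge $b\in E$, the vertices $x,y$ belong to the same strongly biconnected component of $G\setminus\{b\}$. A $2$-edge-biconnected block of $G$ is a maximal vertex subset $U\subseteq V$ with $|U|>1$ such that $x \overset{e}{\leftrightsquigarrow} y$ for all distinct $x,y\in U$. -}

module Defs where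

open import Data.Nat using (ℕ; _<_)
open import Data.Fin using (Fin)
open import Data.Fin.Subset using (Subset; _∈_; _⊆_; ⁅_⁆; _─_; ∣_∣)
open import Data.Product using (Σ; _×_)
open import Data.Sum using (_⊎_)
open import Relation.Binary.PropositionalEquality using (_≡_; _≢_)
open import Relation.Nullary using (¬_)

Digraph : ℕ → Set₁
Digraph n = Fin n → Fin n → Set

Undirected : ∀ {n} → Digraph n → Digraph n
Undirected E x y = E x y ⊎ E y x

data PathIn {n} (E : Digraph n) (C : Subset n) : Fin n → Fin n → Set where
  here : ∀ {x} → x ∈ C → PathIn E C x x
  step : ∀ {x y z} → x ∈ C → E x y → PathIn E C y z → PathIn E C x z

StronglyConnectedOn : ∀ {n} → Digraph n → Subset n → Set
StronglyConnectedOn E C = ∀ x y → x ∈ C → y ∈ C → PathIn E C x y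

ConnectedOn : ∀ {n} → Digraph n → Subset n → Set
ConnectedOn E C = ∀ x y → x ∈ C → y ∈ C → PathIn (Undirected E) C x y

BiconnectedOn : ∀ {n} → Digraph n → Subset n → Set
BiconnectedOn E C = ConnectedOn E C × (∀ v → v ∈ C → ConnectedOn E (C ─ ⁅ v ⁆))

StronglyBiconnectedOn : ∀ {n} → Digraph n → Subset n → Set
StronglyBiconnectedOn E C = StronglyConnectedOn E C × BiconnectedOn E C

SBComponent : ∀ {n} → Digraph n → Subset n → Set
SBComponent E C =
  StronglyBiconnectedOn E C × (∀ D → C ⊆ D → StronglyBiconnectedOn E D → D ⊆ C)

removeEdge : ∀ {n} → Digraph n → Fin n → Fin n → Digraph n
removeEdge E u v x y = E x y × ¬ (x ≡ u × y ≡ v)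

EdgeBiconnRel : ∀ {n} → Digraph n → Fin n → Fin n → Set
EdgeBiconnRel E x y =
  ∀ u v → E u v → Σ _ λ C → SBComponent (removeEdge E u v) C × x ∈ C × y ∈ C

PairwiseRel : ∀ {n} → Digraph n → Subset n → Set
PairwiseRel E U = ∀ x y → x ∈ U → y ∈ U → x ≢ y → EdgeBiconnRel E x y

TwoEdgeBiconnBlock : ∀ {n} → Digraph n → Subset n → Set
TwoEdgeBiconnBlock E U =
  1 < ∣ U ∣ × PairwiseRel E U ×
  (∀ W → U ⊆ W → 1 < ∣ W ∣ → PairwiseRel E W → W ⊆ U)

-- If x ≠ y both lie in U₁ ∩ U₂, then U₁ ∪ U₂ is pairwise related. Given an edge b, let C be
-- the strongly biconnected component of G \ {b} containing x and y. For any w in the union,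
-- the components containing w, x and w, y form with C a triangle of strongly biconnected sets
-- meeting at x, w, y; such a union is again strongly biconnected, so maximality of C puts w
-- in C. Maximality of both blocks then forces U₁ = U₂.
module Submission where

open import Defs
open import Data.Bool.Base using (_∨_)
open import Data.Nat using (ℕ; _≤_; s≤s; _≤?_)
open import Data.Nat.Properties using (≰⇒>; <-≤-trans)
open import Data.Fin using (Fin; zero; suc; _≟_)
open import Data.Fin.Subset
  using (Subset; ⊤; _∩_; _∪_; _─_; _-_; ⁅_⁆; ∣_∣; _∈_; _⊆_; Nonempty; inside; outside)
open import Data.Fin.Subset.Properties
  using ( p⊆p∪q; q⊆p∪q; x∈p∪q⁻; x∈p∩q⁻; p─q⊆p; x∈p∧x≢y⇒x∈p-y; _∈?_
        ; ⊆-antisym; ∣p∣≤∣p∪q∣; ∣q∣≤∣p∪q∣; ∪-comm; ∪-assoc)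
open import Data.Vec.Base using ([]; _∷_; here; there)
open import Data.Product using (∃₂; _×_; _,_)
open import Data.Sum using (_⊎_; inj₁; inj₂; [_,_]′)
open import Function using (_∘′_)
open import Relation.Nullary using (yes; no; contradiction)
open import Relation.Binary.PropositionalEquality
  using (_≡_; _≢_; refl; sym; trans; cong; subst)

1≤∣p∣⇒Nonempty : ∀ {n} (p : Subset n) → 1 ≤ ∣ p ∣ → Nonempty p
1≤∣p∣⇒Nonempty (inside ∷ p) _ = zero , here
1≤∣p∣⇒Nonempty (outside ∷ p) h with 1≤∣p∣⇒Nonempty p h
... | x , x∈p = suc x , there x∈p

2≤∣p∣⇒distinct-members : ∀ {n} (p : Subset n) → 2 ≤ ∣ p ∣ →
                         ∃₂ λ x y → x ∈ p × y ∈ p × x ≢ y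
2≤∣p∣⇒distinct-members (inside ∷ p) (s≤s h) with 1≤∣p∣⇒Nonempty p h
... | y , y∈p = zero , suc y , here , there y∈p , λ ()
2≤∣p∣⇒distinct-members (outside ∷ p) h with 2≤∣p∣⇒distinct-members p h
... | x , y , x∈p , y∈p , x≢y = suc x , suc y , there x∈p , there y∈p , λ { refl → x≢y refl }

∪-distribʳ-─ : ∀ {n} (p q r : Subset n) → (p ∪ q) ─ r ≡ (p ─ r) ∪ (q ─ r)
∪-distribʳ-─ []      []      []            = refl
∪-distribʳ-─ (s ∷ p) (t ∷ q) (inside ∷ r)  = cong (outside ∷_) (∪-distribʳ-─ p q r)
∪-distribʳ-─ (s ∷ p) (t ∷ q) (outside ∷ r) = cong ((s ∨ t) ∷_) (∪-distribʳ-─ p q r)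

module _ {n : ℕ} {R : Digraph n} where

  PathIn-mono : ∀ {S T a b} → S ⊆ T → PathIn R S a b → PathIn R T a b
  PathIn-mono S⊆T (here a∈S)     = here (S⊆T a∈S)
  PathIn-mono S⊆T (step a∈S e p) = step (S⊆T a∈S) e (PathIn-mono S⊆T p)

  PathIn-map : ∀ {R′ : Digraph n} {S a b} → (∀ {x y} → R x y → R′ x y) →
               PathIn R S a b → PathIn R′ S a b
  PathIn-map f (here a∈S)     = here a∈S
  PathIn-map f (step a∈S e p) = step a∈S (f e) (PathIn-map f p)

  _++ᵖ_ : ∀ {S a b c} → PathIn R S a b → PathIn R S b c → PathIn R S a c
  here _       ++ᵖ q = q
  step a∈S e p ++ᵖ q = step a∈S e (p ++ᵖ q)

  StronglyConnectedOn-∪ : ∀ {A B x} → StronglyConnectedOn R A → StronglyConnectedOn R B →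
                          x ∈ A → x ∈ B → StronglyConnectedOn R (A ∪ B)
  StronglyConnectedOn-∪ {A} {B} {x} scA scB x∈A x∈B a b a∈ b∈ =
    join (x∈p∪q⁻ A B a∈) (x∈p∪q⁻ A B b∈)
    where
    inA : ∀ {a b} → PathIn R A a b → PathIn R (A ∪ B) a b
    inA = PathIn-mono (p⊆p∪q B)
    inB : ∀ {a b} → PathIn R B a b → PathIn R (A ∪ B) a b
    inB = PathIn-mono (q⊆p∪q A B)
    join : a ∈ A ⊎ a ∈ B → b ∈ A ⊎ b ∈ B → PathIn R (A ∪ B) a b
    join (inj₁ a∈A) (inj₁ b∈A) = inA (scA a b a∈A b∈A)
    join (inj₁ a∈A) (inj₂ b∈B) = inA (scA a x a∈A x∈A) ++ᵖ inB (scB x b x∈B b∈B)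
    join (inj₂ a∈B) (inj₁ b∈A) = inB (scB a x a∈B x∈B) ++ᵖ inA (scA x b x∈A b∈A)
    join (inj₂ a∈B) (inj₂ b∈B) = inB (scB a b a∈B b∈B)

  StronglyConnectedOn-∪₃ : ∀ {A B C x w} →
    StronglyConnectedOn R A → StronglyConnectedOn R B → StronglyConnectedOn R C →
    x ∈ A → x ∈ B → w ∈ B → w ∈ C → StronglyConnectedOn R (A ∪ B ∪ C)
  StronglyConnectedOn-∪₃ {C = C} scA scB scC x∈A x∈B w∈B w∈C =
    StronglyConnectedOn-∪ scA (StronglyConnectedOn-∪ scB scC w∈B w∈C) x∈A (p⊆p∪q C x∈B)

ConnectedOn-minus : ∀ {n} {E : Digraph n} {C : Subset n} →
                    BiconnectedOn E C → ∀ v → ConnectedOn E (C - v)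
ConnectedOn-minus {C = C} (connected , connected-minus) v with v ∈? C
... | yes v∈C = connected-minus v v∈C
... | no  v∉C = λ a b a∈ b∈ → PathIn-mono C⊆C-v (connected a b (p─q⊆p C ⁅ v ⁆ a∈) (p─q⊆p C ⁅ v ⁆ b∈))
  where
  C⊆C-v : C ⊆ C - v
  C⊆C-v a∈C = x∈p∧x≢y⇒x∈p-y a∈C (λ { refl → v∉C a∈C })

-- Removing any vertex v of the triangle x, w, y leaves two of its corners, which still chain
-- the three sets A - v, B - v, C - v together. ConnectedOn E is StronglyConnectedOn (Undirected E)
-- by definition, so the union lemmas apply to it.
StronglyBiconnectedOn-triangle : ∀ {n} {E : Digraph n} {A B C : Subset n} {x w y : Fin n} →
  StronglyBiconnectedOn E A → StronglyBiconnectedOn E B → StronglyBiconnectedOn E C →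
  x ∈ A → x ∈ B → w ∈ B → w ∈ C → y ∈ C → y ∈ A →
  x ≢ y → w ≢ x → w ≢ y → StronglyBiconnectedOn E (A ∪ B ∪ C)
StronglyBiconnectedOn-triangle {E = E} {A} {B} {C} {x} {w} {y}
  (scA , bcA) (scB , bcB) (scC , bcC) x∈A x∈B w∈B w∈C y∈C y∈A x≢y w≢x w≢y =
  sc , (λ a b a∈ b∈ → PathIn-map inj₁ (sc a b a∈ b∈)) , λ v _ → connected-minus v
  where
  sc : StronglyConnectedOn E (A ∪ B ∪ C)
  sc = StronglyConnectedOn-∪₃ scA scB scC x∈A x∈B w∈B w∈C

  minus-∪₃ : ∀ v → (A ∪ B ∪ C) - v ≡ (A - v) ∪ (B - v) ∪ (C - v)
  minus-∪₃ v = trans (∪-distribʳ-─ A (B ∪ C) ⁅ v ⁆) (cong ((A - v) ∪_) (∪-distribʳ-─ B C ⁅ v ⁆))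

  cover : ∀ v → ConnectedOn E ((A - v) ∪ (B - v) ∪ (C - v))
  cover v with v ≟ x | v ≟ w
  ... | yes refl | _ =
    subst (ConnectedOn E) (cong ((A - v) ∪_) (∪-comm (C - v) (B - v)))
      (StronglyConnectedOn-∪₃ (ConnectedOn-minus bcA v) (ConnectedOn-minus bcC v) (ConnectedOn-minus bcB v)
        (x∈p∧x≢y⇒x∈p-y y∈A (x≢y ∘′ sym)) (x∈p∧x≢y⇒x∈p-y y∈C (x≢y ∘′ sym))
        (x∈p∧x≢y⇒x∈p-y w∈C w≢x) (x∈p∧x≢y⇒x∈p-y w∈B w≢x))
  ... | no v≢x | yes refl =
    subst (ConnectedOn E) swap
      (StronglyConnectedOn-∪₃ (ConnectedOn-minus bcB v) (ConnectedOn-minus bcA v) (ConnectedOn-minus bcC v)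
        (x∈p∧x≢y⇒x∈p-y x∈B (w≢x ∘′ sym)) (x∈p∧x≢y⇒x∈p-y x∈A (w≢x ∘′ sym))
        (x∈p∧x≢y⇒x∈p-y y∈A (w≢y ∘′ sym)) (x∈p∧x≢y⇒x∈p-y y∈C (w≢y ∘′ sym)))
    where
    swap : (B - v) ∪ (A - v) ∪ (C - v) ≡ (A - v) ∪ (B - v) ∪ (C - v)
    swap = trans (sym (∪-assoc (B - v) (A - v) (C - v)))
                 (trans (cong (_∪ (C - v)) (∪-comm (B - v) (A - v))) (∪-assoc (A - v) (B - v) (C - v)))
  ... | no v≢x | no v≢w =
    StronglyConnectedOn-∪₃ (ConnectedOn-minus bcA v) (ConnectedOn-minus bcB v) (ConnectedOn-minus bcC v)
      (x∈p∧x≢y⇒x∈p-y x∈A (v≢x ∘′ sym)) (x∈p∧x≢y⇒x∈p-y x∈B (v≢x ∘′ sym))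
      (x∈p∧x≢y⇒x∈p-y w∈B (v≢w ∘′ sym)) (x∈p∧x≢y⇒x∈p-y w∈C (v≢w ∘′ sym))

  connected-minus : ∀ v → ConnectedOn E ((A ∪ B ∪ C) - v)
  connected-minus v = subst (ConnectedOn E) (sym (minus-∪₃ v)) (cover v)

PairwiseRel⇒⊆-component : ∀ {n} {E : Digraph n} {U C : Subset n} {x y u v : Fin n} → E u v →
  PairwiseRel E U → x ∈ U → y ∈ U → x ≢ y →
  SBComponent (removeEdge E u v) C → x ∈ C → y ∈ C → U ⊆ C
PairwiseRel⇒⊆-component {C = C} {x} {y} e rel x∈U y∈U x≢y (sbC , maximal) x∈C y∈C {w} w∈U
  with w ≟ x | w ≟ y
... | yes refl | _        = x∈C
... | no _     | yes refl = y∈C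
... | no w≢x   | no w≢y
  with rel w x w∈U x∈U w≢x _ _ e | rel w y w∈U y∈U w≢y _ _ e
... | B , (sbB , _) , w∈B , x∈B | D , (sbD , _) , w∈D , y∈D =
  maximal (C ∪ B ∪ D) (p⊆p∪q (B ∪ D))
    (StronglyBiconnectedOn-triangle sbC sbB sbD x∈C x∈B w∈B w∈D y∈D y∈C x≢y w≢x w≢y)
    (q⊆p∪q C (B ∪ D) (p⊆p∪q D w∈B))

PairwiseRel-∪ : ∀ {n} {E : Digraph n} {U₁ U₂ : Subset n} {x y : Fin n} →
  PairwiseRel E U₁ → PairwiseRel E U₂ → x ∈ U₁ ∩ U₂ → y ∈ U₁ ∩ U₂ → x ≢ y →
  PairwiseRel E (U₁ ∪ U₂)
PairwiseRel-∪ {U₁ = U₁} {U₂} {x} {y} rel₁ rel₂ x∈ y∈ x≢y a b a∈ b∈ _ u v e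
  with x∈p∩q⁻ U₁ U₂ x∈ | x∈p∩q⁻ U₁ U₂ y∈
... | x∈U₁ , x∈U₂ | y∈U₁ , y∈U₂ with rel₁ x y x∈U₁ y∈U₁ x≢y u v e
... | C , component , x∈C , y∈C =
  C , component , U₁∪U₂⊆C a∈ , U₁∪U₂⊆C b∈
  where
  U₁∪U₂⊆C : U₁ ∪ U₂ ⊆ C
  U₁∪U₂⊆C c∈ = [ PairwiseRel⇒⊆-component e rel₁ x∈U₁ y∈U₁ x≢y component x∈C y∈C
               , PairwiseRel⇒⊆-component e rel₂ x∈U₂ y∈U₂ x≢y component x∈C y∈C
               ]′ (x∈p∪q⁻ U₁ U₂ c∈)

TwoEdgeBiconnBlock-unique : ∀ {n} {E : Digraph n} {U₁ U₂ : Subset n} {x y : Fin n} →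
  TwoEdgeBiconnBlock E U₁ → TwoEdgeBiconnBlock E U₂ →
  x ∈ U₁ ∩ U₂ → y ∈ U₁ ∩ U₂ → x ≢ y → U₁ ≡ U₂
TwoEdgeBiconnBlock-unique {U₁ = U₁} {U₂} (1<∣U₁∣ , rel₁ , maximal₁) (1<∣U₂∣ , rel₂ , maximal₂) x∈ y∈ x≢y =
  ⊆-antisym (λ a∈U₁ → U₁∪U₂⊆U₂ (p⊆p∪q U₂ a∈U₁)) (λ a∈U₂ → U₁∪U₂⊆U₁ (q⊆p∪q U₁ U₂ a∈U₂))
  where
  rel : PairwiseRel _ (U₁ ∪ U₂)
  rel = PairwiseRel-∪ rel₁ rel₂ x∈ y∈ x≢y
  U₁∪U₂⊆U₁ : U₁ ∪ U₂ ⊆ U₁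
  U₁∪U₂⊆U₁ = maximal₁ (U₁ ∪ U₂) (p⊆p∪q U₂) (<-≤-trans 1<∣U₁∣ (∣p∣≤∣p∪q∣ U₁ U₂)) rel
  U₁∪U₂⊆U₂ : U₁ ∪ U₂ ⊆ U₂
  U₁∪U₂⊆U₂ = maximal₂ (U₁ ∪ U₂) (q⊆p∪q U₁ U₂) (<-≤-trans 1<∣U₂∣ (∣q∣≤∣p∪q∣ U₁ U₂)) rel

lemma2 : (n : ℕ) (E : Digraph n) → StronglyBiconnectedOn E ⊤ →
         (U₁ U₂ : Subset n) → TwoEdgeBiconnBlock E U₁ → TwoEdgeBiconnBlock E U₂ →
         U₁ ≢ U₂ → ∣ U₁ ∩ U₂ ∣ ≤ 1
lemma2 n E _ U₁ U₂ block₁ block₂ U₁≢U₂ with ∣ U₁ ∩ U₂ ∣ ≤? 1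
... | yes ∣U₁∩U₂∣≤1 = ∣U₁∩U₂∣≤1
... | no ∣U₁∩U₂∣≰1 with 2≤∣p∣⇒distinct-members (U₁ ∩ U₂) (≰⇒> ∣U₁∩U₂∣≰1)
... | x , y , x∈ , y∈ , x≢y = contradiction (TwoEdgeBiconnBlock-unique block₁ block₂ x∈ y∈ x≢y) U₁≢U₂
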